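{- Let $P$ be a poset on $\{1,\ldots,n\}$ and let $F$ be a $P$-forest. Then $\{\Lambda_1^F,\Lambda_2^F,\ldots,\Lambda_n^F\}$ is a maximum independent set of $G_P$ (in particular, every independent set of $G_P$ has at most $n$ elements).
   Context: An order ideal of $P$ is a subset $J$ with $i\in J$, $j\le_P i\Rightarrow j\in J$; a nonempty order ideal is connected if the Hasse diagram of $P$ restricted to it is connected. Sets $A,B$ intersect nontrivially if $A\cap B\ne\emptyset$, $A\not\subseteq B$, $B\not\subseteq A$. $G_P$ is the simple graph whose vertices are the connected order ideals of $P$, adjacent iff they intersect nontrivially. A maximum independent set is an independent set of largest possible size. For a poset $F$ on $[n]$, $\Lambda_i^F=\{j: j\le_F i\}$. A $P$-forest is a poset $F$ on $[n]$ in which each element is covered by at most one element, such that each $\Lambda_i^F$ is a connected order ideal of $P$ and, for any $i,j$ incomparable in $F$, $\Lambda_i^F\cup\Lambda_j^F$ is a disconnected order ideal of $P$. -}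

module Defs where

open import Level using (0ℓ)
open import Data.Nat using (ℕ; _≤_)
open import Data.Fin using (Fin)
open import Data.Fin.Subset using (Subset; _∈_; _⊆_; _∪_)
open import Data.Vec using (tabulate)
open import Data.List using (List; []; _∷_; length)
open import Data.List.Relation.Unary.All using (All)
open import Data.List.Relation.Unary.AllPairs using (AllPairs)
open import Data.Product using (_×_; ∃; ∃-syntax)
open import Data.Sum using (_⊎_)
open import Relation.Nullary using (¬_; does)
open import Relation.Binary.Core using (Rel)
open import Relation.Binary.Definitions using (Decidable)
open import Relation.Binary.Structures using (IsPartialOrder)
open import Relation.Binary.PropositionalEquality using (_≡_; _≢_)
open import Function using (Injective)

record FinPoset (n : ℕ) : Set₁ where
  field
    _≼_            : Rel (Fin n) 0ℓ
    isPartialOrder : IsPartialOrder _≡_ _≼_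
    _≼?_           : Decidable _≼_

  _≺_ : Rel (Fin n) 0ℓ
  i ≺ j = i ≼ j × i ≢ j

  _⋖_ : Rel (Fin n) 0ℓ
  i ⋖ j = i ≺ j × ¬ (∃[ k ] (i ≺ k × k ≺ j))


module _ {n : ℕ} (P : FinPoset n) where
  open FinPoset P using (_⋖_) renaming (_≼_ to _≤P_)

  IsOrderIdeal : Subset n → Set
  IsOrderIdeal J = ∀ i j → i ∈ J → j ≤P i → j ∈ J

  HasseEdge : Fin n → Fin n → Set
  HasseEdge i j = (i ⋖ j) ⊎ (j ⋖ i)

  data PathIn (J : Subset n) : Fin n → Fin n → Set where
    here : ∀ {x} → x ∈ J → PathIn J x x
    step : ∀ {x y z} → x ∈ J → HasseEdge x y → PathIn J y z → PathIn J x z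

  HasseConnected : Subset n → Set
  HasseConnected J = ∀ x y → x ∈ J → y ∈ J → PathIn J x y

  IsConnectedIdeal : Subset n → Set
  IsConnectedIdeal J = IsOrderIdeal J × (∃[ x ] x ∈ J) × HasseConnected J

  IsDisconnectedIdeal : Subset n → Set
  IsDisconnectedIdeal J = IsOrderIdeal J × ¬ IsConnectedIdeal J

NontrivInter : ∀ {n} → Subset n → Subset n → Set
NontrivInter A B = (∃[ x ] (x ∈ A × x ∈ B)) × ¬ (A ⊆ B) × ¬ (B ⊆ A)

-- independent sets of G_P, given as duplicate-free lists of vertices
-- (connected order ideals of P), pairwise non-adjacent
IsIndependent : ∀ {n} → FinPoset n → List (Subset n) → Set
IsIndependent P S =
  All (IsConnectedIdeal P) S × AllPairs (λ A B → A ≢ B × ¬ NontrivInter A B) S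

Λ : ∀ {n} → FinPoset n → Fin n → Subset n
Λ F i = tabulate (λ j → does (FinPoset._≼?_ F j i))

IsPForest : ∀ {n} → FinPoset n → FinPoset n → Set
IsPForest {n} P F =
  (∀ i j k → FinPoset._⋖_ F i j → FinPoset._⋖_ F i k → j ≡ k)
  × (∀ i → IsConnectedIdeal P (Λ F i))
  × (∀ i j → ¬ (FinPoset._≼_ F i j) → ¬ (FinPoset._≼_ F j i) → IsDisconnectedIdeal P (Λ F i ∪ Λ F j))

-- {Λ_1^F, …, Λ_n^F} is a maximum independent set of G_P:
-- its members are vertices, pairwise non-adjacent, it has exactly n elements
-- (i ↦ Λ_i^F injective), and every independent set has at most n elements.
IsMaximumIndependentFamily : ∀ {n} → FinPoset n → (Fin n → Subset n) → Set
IsMaximumIndependentFamily {n} P L =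
  (∀ i → IsConnectedIdeal P (L i))
  × (∀ i j → ¬ NontrivInter (L i) (L j))
  × Injective _≡_ _≡_ L
  × (∀ S → IsIndependent P S → length S ≤ n)

-- Two connected order ideals that meet have a connected union, so for a P-forest the
-- ideals Λᵢ are pairwise nested or disjoint: they form a laminar family.  Conversely,
-- every member J of a laminar family of distinct connected ideals owns a private
-- element, lying in no member strictly inside J.  Otherwise, from any member K ⊂ J,
-- connectedness of J yields a cover u ⋖ v with u ∈ K and v ∈ J ∖ K; the member
-- containing v also contains u, hence strictly contains K, and iterating gives an
-- infinite strictly increasing chain of subsets of [n].  Distinct members have distinct
-- private elements, so an independent set of G_P has at most n elements.
module Submission where

open import Defs
open import Data.Nat using (ℕ; _≤_)
open import Data.Fin using (Fin; zero; suc)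
open import Data.Fin.Properties using (any?; injective⇒≤)
open import Data.Fin.Subset using (Subset; _∈_; _∉_; _⊆_; _⊂_; _⊃_; _∪_)
open import Data.Fin.Subset.Properties
  using (_∈?_; _⊆?_; _⊂?_; ⊆-antisym; p⊆p∪q; q⊆p∪q; x∈p∪q⁻; x∈p∪q⁺)
open import Data.Fin.Subset.Induction using (Acc; acc; ⊃-wellFounded)
open import Data.Vec.Properties using ([]=⇒lookup; lookup⇒[]=; lookup∘tabulate)
open import Data.List using (List; _∷_; length; lookup)
open import Data.List.Membership.Propositional.Properties using (∈-lookup; ∈-AllPairs₂)
import Data.List.Relation.Unary.All as All
open import Data.List.Relation.Unary.AllPairs as AllPairs using (AllPairs; _∷_)
open import Data.Product using (_×_; _,_; proj₁; proj₂; ∃-syntax; ∃₂)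
open import Data.Sum as Sum using (_⊎_; inj₁; inj₂; [_,_]′)
open import Function using (Injective; _∘_)
open import Relation.Nullary using (¬_; Dec; yes; no; does; contradiction)
open import Relation.Nullary.Decidable using (_×-dec_; ¬?; dec-true; decidable-stable)
open import Relation.Binary.PropositionalEquality using (_≡_; _≢_; refl; sym; trans; cong; subst)
open import Relation.Binary.Structures using (IsPartialOrder)

lookup-injective : ∀ {A : Set} {xs : List A} → AllPairs _≢_ xs → Injective _≡_ _≡_ (lookup xs)
lookup-injective (_  ∷ _)  {zero}  {zero}  _  = refl
lookup-injective (x≢ ∷ _)  {zero}  {suc j} eq = contradiction eq (All.lookup x≢ (∈-lookup j))
lookup-injective (x≢ ∷ _)  {suc i} {zero}  eq = contradiction (sym eq) (All.lookup x≢ (∈-lookup i))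
lookup-injective (_  ∷ ps) {suc i} {suc j} eq = cong suc (lookup-injective ps eq)

module _ {n : ℕ} where

  NontrivInter-sym : {A B : Subset n} → NontrivInter A B → NontrivInter B A
  NontrivInter-sym ((x , x∈A , x∈B) , A⊈B , B⊈A) = (x , x∈B , x∈A) , B⊈A , A⊈B

  ¬NontrivInter-refl : {A : Subset n} → ¬ NontrivInter A A
  ¬NontrivInter-refl (_ , A⊈A , _) = A⊈A (λ x∈A → x∈A)

  ¬NontrivInter⇒⊆⊎⊇ : {A B : Subset n} {x : Fin n} →
                        x ∈ A → x ∈ B → ¬ NontrivInter A B → A ⊆ B ⊎ B ⊆ A
  ¬NontrivInter⇒⊆⊎⊇ {A} {B} x∈A x∈B ¬AB with A ⊆? B | B ⊆? A
  ... | yes A⊆B | _       = inj₁ A⊆B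
  ... | no  _   | yes B⊆A = inj₂ B⊆A
  ... | no  A⊈B | no  B⊈A = contradiction ((_ , x∈A , x∈B) , A⊈B , B⊈A) ¬AB

  ⊆∧⊄⇒≡ : {A B : Subset n} → A ⊆ B → ¬ A ⊂ B → A ≡ B
  ⊆∧⊄⇒≡ {A} A⊆B A⊄B =
    ⊆-antisym A⊆B (λ {y} y∈B → decidable-stable (y ∈? A) (λ y∉A → A⊄B (A⊆B , y , y∈B , y∉A)))

Laminar : ∀ {m n} → (Fin m → Subset n) → Set
Laminar L = ∀ a b → ¬ NontrivInter (L a) (L b)

module HasseDiagram {n : ℕ} (P : FinPoset n) where
  open FinPoset P using (_⋖_)

  path-head : ∀ {J x y} → PathIn P J x y → x ∈ J
  path-head (here x∈J)     = x∈J
  path-head (step x∈J _ _) = x∈J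

  path-⊆ : ∀ {J J′ x y} → J ⊆ J′ → PathIn P J x y → PathIn P J′ x y
  path-⊆ J⊆J′ (here x∈J)      = here (J⊆J′ x∈J)
  path-⊆ J⊆J′ (step x∈J e p) = step (J⊆J′ x∈J) e (path-⊆ J⊆J′ p)

  path-++ : ∀ {J x y z} → PathIn P J x y → PathIn P J y z → PathIn P J x z
  path-++ (here _)       q = q
  path-++ (step x∈J e p) q = step x∈J e (path-++ p q)

  path-exit : ∀ {J s t} (K : Subset n) → PathIn P J s t → s ∈ K → t ∉ K →
              ∃₂ λ u v → u ∈ K × v ∈ J × v ∉ K × HasseEdge P u v
  path-exit K (here _) s∈K t∉K = contradiction s∈K t∉K
  path-exit K (step {x} {y} _ e p) x∈K t∉K with y ∈? K
  ... | yes y∈K = path-exit K p y∈K t∉K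
  ... | no  y∉K = x , y , x∈K , path-head p , y∉K , e

  -- An edge leaving an order ideal K must go upwards.
  ideal-exit-cover : ∀ {J K s t} → IsOrderIdeal P K → HasseConnected P J →
                     s ∈ K → s ∈ J → t ∈ J → t ∉ K →
                     ∃₂ λ u v → u ∈ K × v ∈ J × v ∉ K × u ⋖ v
  ideal-exit-cover {K = K} {s} {t} idealK connJ s∈K s∈J t∈J t∉K
    with path-exit K (connJ s t s∈J t∈J) s∈K t∉K
  ... | u , v , u∈K , v∈J , v∉K , inj₁ u⋖v = u , v , u∈K , v∈J , v∉K , u⋖v
  ... | u , v , u∈K , v∈J , v∉K , inj₂ v⋖u = contradiction (idealK u v u∈K (proj₁ (proj₁ v⋖u))) v∉K

  IsOrderIdeal-∪ : ∀ {A B} → IsOrderIdeal P A → IsOrderIdeal P B → IsOrderIdeal P (A ∪ B)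
  IsOrderIdeal-∪ {A} {B} idealA idealB i j i∈A∪B j≤i =
    x∈p∪q⁺ (Sum.map (λ i∈A → idealA i j i∈A j≤i) (λ i∈B → idealB i j i∈B j≤i) (x∈p∪q⁻ A B i∈A∪B))

  HasseConnected-∪ : ∀ {A B x} → HasseConnected P A → HasseConnected P B →
                     x ∈ A → x ∈ B → HasseConnected P (A ∪ B)
  HasseConnected-∪ {A} {B} {x} connA connB x∈A x∈B a b a∈A∪B b∈A∪B =
    path-++ (inside (Sum.map (_, x∈A) (_, x∈B) (x∈p∪q⁻ A B a∈A∪B)))
            (inside (Sum.map (x∈A ,_) (x∈B ,_) (x∈p∪q⁻ A B b∈A∪B)))
    where
    inside : ∀ {y z} → (y ∈ A × z ∈ A) ⊎ (y ∈ B × z ∈ B) → PathIn P (A ∪ B) y z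
    inside (inj₁ (y∈A , z∈A)) = path-⊆ (p⊆p∪q B) (connA _ _ y∈A z∈A)
    inside (inj₂ (y∈B , z∈B)) = path-⊆ (q⊆p∪q A B) (connB _ _ y∈B z∈B)

  IsConnectedIdeal-∪ : ∀ {A B x} → IsConnectedIdeal P A → IsConnectedIdeal P B →
                       x ∈ A → x ∈ B → IsConnectedIdeal P (A ∪ B)
  IsConnectedIdeal-∪ (idealA , _ , connA) (idealB , _ , connB) x∈A x∈B =
    IsOrderIdeal-∪ idealA idealB , (_ , x∈p∪q⁺ (inj₁ x∈A)) , HasseConnected-∪ connA connB x∈A x∈B

module LaminarFamily {n m : ℕ} (P : FinPoset n) (L : Fin m → Subset n)
                     (connected : ∀ a → IsConnectedIdeal P (L a)) (laminar : Laminar L) where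
  open FinPoset P using (_⋖_)
  open HasseDiagram P using (ideal-exit-cover)

  CoveredIn : Subset n → Fin n → Set
  CoveredIn J x = ∃[ b ] L b ⊂ J × x ∈ L b

  IsPrivate : Fin m → Fin n → Set
  IsPrivate a x = x ∈ L a × ¬ CoveredIn (L a) x

  larger-member : ∀ {a b} → (∀ x → x ∈ L a → CoveredIn (L a) x) → L b ⊂ L a →
                  ∃[ c ] L b ⊂ L c × L c ⊂ L a
  larger-member {a} {b} covered (Lb⊆La , t , t∈La , t∉Lb)
    with connected b | connected a
  ... | idealb , (s , s∈Lb) , _ | _ , _ , conna
    with ideal-exit-cover idealb conna s∈Lb (Lb⊆La s∈Lb) t∈La t∉Lb
  ... | u , v , u∈Lb , v∈La , v∉Lb , u⋖v
    with covered v v∈La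
  ... | c , Lc⊂La , v∈Lc
    with ¬NontrivInter⇒⊆⊎⊇ u∈Lb (proj₁ (connected c) v u v∈Lc (proj₁ (proj₁ u⋖v))) (laminar b c)
  ... | inj₁ Lb⊆Lc = c , (Lb⊆Lc , v , v∈Lc , v∉Lb) , Lc⊂La
  ... | inj₂ Lc⊆Lb = contradiction (Lc⊆Lb v∈Lc) v∉Lb

  ¬all-covered : ∀ a → ¬ (∀ x → x ∈ L a → CoveredIn (L a) x)
  ¬all-covered a covered with connected a
  ... | _ , (x , x∈La) , _ with covered x x∈La
  ... | b , Lb⊂La , _ = ascend b (⊃-wellFounded (L b)) Lb⊂La
    where
    ascend : ∀ b → Acc _⊃_ (L b) → ¬ L b ⊂ L a
    ascend b (acc larger) Lb⊂La with larger-member covered Lb⊂La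
    ... | c , Lb⊂Lc , Lc⊂La = ascend c (larger Lb⊂Lc) Lc⊂La

  CoveredIn? : ∀ J x → Dec (CoveredIn J x)
  CoveredIn? J x = any? (λ b → (L b ⊂? J) ×-dec (x ∈? L b))

  private-element : ∀ a → ∃[ x ] IsPrivate a x
  private-element a with any? (λ x → (x ∈? L a) ×-dec ¬? (CoveredIn? (L a) x))
  ... | yes found = found
  ... | no  none  = contradiction
    (λ x x∈La → decidable-stable (CoveredIn? (L a) x) (λ ¬cov → none (x , x∈La , ¬cov)))
    (¬all-covered a)

  private-⊆⇒≡ : ∀ {a b x} → IsPrivate b x → x ∈ L a → L a ⊆ L b → L a ≡ L b
  private-⊆⇒≡ {a} (_ , ¬cov) x∈La La⊆Lb = ⊆∧⊄⇒≡ La⊆Lb (λ La⊂Lb → ¬cov (a , La⊂Lb , x∈La))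

  private-injective : Injective _≡_ _≡_ L → Injective _≡_ _≡_ (proj₁ ∘ private-element)
  private-injective L-injective {a} {b} x≡y =
    L-injective ([ private-⊆⇒≡ privᵇ (proj₁ privᵃ) , sym ∘ private-⊆⇒≡ privᵃ (proj₁ privᵇ) ]′
                   (¬NontrivInter⇒⊆⊎⊇ (proj₁ privᵃ) (proj₁ privᵇ) (laminar a b)))
    where
    privᵃ : IsPrivate a (proj₁ (private-element a))
    privᵃ = proj₂ (private-element a)
    privᵇ : IsPrivate b (proj₁ (private-element a))
    privᵇ = subst (IsPrivate b) (sym x≡y) (proj₂ (private-element b))

  size-≤ : Injective _≡_ _≡_ L → m ≤ n
  size-≤ = injective⇒≤ ∘ private-injective

independent-length-≤ : ∀ {n} (P : FinPoset n) (S : List (Subset n)) →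
                       IsIndependent P S → length S ≤ n
independent-length-≤ P S (connected , pairs) =
  LaminarFamily.size-≤ P (lookup S) (All.lookup connected ∘ ∈-lookup) laminar
    (lookup-injective (AllPairs.map proj₁ pairs))
  where
  laminar : Laminar (lookup S)
  laminar a b with ∈-AllPairs₂ pairs (∈-lookup a) (∈-lookup b)
  ... | inj₁ Sa≡Sb            = subst (¬_ ∘ NontrivInter (lookup S a)) Sa≡Sb ¬NontrivInter-refl
  ... | inj₂ (inj₁ (_ , ¬ab)) = ¬ab
  ... | inj₂ (inj₂ (_ , ¬ba)) = ¬ba ∘ NontrivInter-sym

module Forest {n : ℕ} (P F : FinPoset n) where
  open FinPoset F using (_≼?_) renaming (_≼_ to _≼F_)
  open IsPartialOrder (FinPoset.isPartialOrder F)
    using () renaming (refl to ≼-refl; trans to ≼-trans; antisym to ≼-antisym)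

  ∈Λ⁻ : ∀ {x i} → x ∈ Λ F i → x ≼F i
  ∈Λ⁻ {x} {i} x∈Λi
    with x ≼? i | trans (sym (lookup∘tabulate (λ j → does (j ≼? i)) x)) ([]=⇒lookup x∈Λi)
  ... | yes x≼i | _ = x≼i
  ... | no  _   | ()

  ∈Λ⁺ : ∀ {x i} → x ≼F i → x ∈ Λ F i
  ∈Λ⁺ {x} {i} x≼i =
    lookup⇒[]= x _ (trans (lookup∘tabulate (λ j → does (j ≼? i)) x) (dec-true (x ≼? i) x≼i))

  Λ-mono : ∀ {i j} → i ≼F j → Λ F i ⊆ Λ F j
  Λ-mono i≼j x∈Λi = ∈Λ⁺ (≼-trans (∈Λ⁻ x∈Λi) i≼j)

  Λ-injective : Injective _≡_ _≡_ (Λ F)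
  Λ-injective {i} {j} Λi≡Λj =
    ≼-antisym (∈Λ⁻ (subst (i ∈_) Λi≡Λj (∈Λ⁺ ≼-refl))) (∈Λ⁻ (subst (j ∈_) (sym Λi≡Λj) (∈Λ⁺ ≼-refl)))

  Λ-laminar : IsPForest P F → Laminar (Λ F)
  Λ-laminar (_ , connected , incomparable) i j ((x , x∈Λi , x∈Λj) , Λi⊈Λj , Λj⊈Λi)
    with i ≼? j | j ≼? i
  ... | yes i≼j | _       = Λi⊈Λj (Λ-mono i≼j)
  ... | no  _   | yes j≼i = Λj⊈Λi (Λ-mono j≼i)
  ... | no  i⋠j | no  j⋠i =
    proj₂ (incomparable i j i⋠j j⋠i) (IsConnectedIdeal-∪ (connected i) (connected j) x∈Λi x∈Λj)
    where open HasseDiagram P using (IsConnectedIdeal-∪)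

lemma2p2 : ∀ (n : ℕ) (P F : FinPoset n) → IsPForest P F → IsMaximumIndependentFamily P (Λ F)
lemma2p2 n P F forest@(_ , connected , _) =
  connected , Λ-laminar forest , Λ-injective , independent-length-≤ P
  where open Forest P F
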